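{- For every $n\ge 1$, $$pre_2(n)\ \ge\ \begin{cases}\dfrac{\tau(n+1)}{2}, & \text{if } n+1 \text{ is not a perfect square},\\[2mm] \dfrac{\tau(n+1)+1}{2}, & \text{if } n+1 \text{ is a perfect square},\end{cases}$$ where $\tau(m)$ denotes the number of positive divisors of $m$.
   Context: A partition $\lambda=(\lambda_1,\dots,\lambda_\ell)$ of $n$ is a non-increasing sequence of positive integers summing to $n$. The map $pre_2$ sends a partition $\lambda$ with $\ell\ge 2$ parts to the partition whose multiset of parts is $\{\lambda_i\lambda_j : 1\le i<j\le \ell\}$ (and sends partitions with fewer than two parts to the empty partition). $pre_2(n)$ denotes the number of partitions of $n$ that lie in the image of the map $pre_2$ (i.e. partitions $\nu$ of $n$ for which there exists a partition $\lambda$, of any integer, with $pre_2(\lambda)=\nu$). -}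

module Defs where

open import Data.Nat using (ℕ; zero; suc; _+_; _*_; _≤_; _<_; _≥_)
open import Data.Nat.Divisibility using (_∣_; _∣?_)
open import Data.List using (List; []; _∷_; map; _++_; filter; length; upTo)
open import Data.Nat.ListAction using (sum)
open import Relation.Binary.PropositionalEquality using (_≡_)
open import Data.List.Relation.Unary.All using (All)
open import Data.List.Relation.Unary.Linked using (Linked)
open import Data.List.Relation.Binary.Permutation.Propositional using (_↭_)
open import Data.Product using (Σ; ∃; _×_)

IsPartition : List ℕ → Set
IsPartition λs = Linked _≥_ λs × All (0 <_) λs

IsPartitionOf : ℕ → List ℕ → Set
IsPartitionOf n λs = IsPartition λs × sum λs ≡ n

pairProducts : List ℕ → List ℕ
pairProducts []       = []
pairProducts (x ∷ xs) = map (x *_) xs ++ pairProducts xs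

-- ν lies in the image of pre_2: ν equals (as a multiset, hence as a sorted
-- partition) the parts of pre_2(λ) for some partition λ of any integer.
InImagePre2 : List ℕ → Set
InImagePre2 ν = ∃ λ λs → IsPartition λs × (pairProducts λs ↭ ν)

τ : ℕ → ℕ
τ m = length (filter (_∣? m) (map suc (upTo m)))

IsSquare : ℕ → Set
IsSquare m = ∃ λ k → k * k ≡ m

{-# OPTIONS --safe #-}
-- Write n + 1 = q d with d² ≤ n + 1. The partition λ = (q − 1, d − 1, 1), or (n, 1) when d = 1,
-- has pair products (q − 1)(d − 1), q − 1, d − 1, which sum to q d − 1 = n and are sorted
-- because q ≥ d; the last part recovers d, so distinct d give distinct partitions.
-- Since d ↦ (n + 1) / d maps the divisors with d² > n + 1 injectively to those with
-- d² ≤ n + 1, missing √(n + 1) when n + 1 is a square, at least half of the τ(n + 1)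
-- divisors (strictly more than half in the square case) satisfy d² ≤ n + 1.
module Submission where

open import Defs
open import Data.Nat
  using (ℕ; zero; suc; pred; _+_; _*_; _≤_; _<_; _≤?_; s≤s; s≤s⁻¹; z≤n; NonZero; ≢-nonZero⁻¹)
open import Data.Nat.Properties
open import Data.Nat.DivMod using (_/_; m/n*n≡m)
open import Data.Nat.Divisibility using (_∣_; _∣?_; divides; ∣⇒≤; 0∣⇒≡0)
open import Data.Nat.ListAction using (sum)
open import Data.Nat.Tactic.RingSolver using (solve-∀)
open import Data.Fin using (zero; suc)
open import Data.Fin.Properties using (injective⇒≤)
open import Data.List using (List; []; _∷_; length; map; filter; upTo; lookup)
open import Data.List.Properties using (length-map)
open import Data.List.Relation.Unary.All as All using (All; []; _∷_)
import Data.List.Relation.Unary.All.Properties as All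
open import Data.List.Relation.Unary.Any using (index)
open import Data.List.Relation.Unary.Linked using ([-]; _∷_)
open import Data.List.Relation.Unary.AllPairs using (_∷_)
open import Data.List.Relation.Unary.Unique.Propositional using (Unique)
import Data.List.Relation.Unary.Unique.Propositional.Properties as Unique
open import Data.List.Membership.Propositional using (_∈_)
open import Data.List.Membership.Propositional.Properties
  using (∈-lookup; ∈-map⁺; ∈-filter⁺; ∈-filter⁻; ∈-upTo⁺)
import Data.List.Membership.Setoid.Properties as SetoidMembership
open import Data.List.Relation.Binary.Permutation.Propositional using (↭-refl)
open import Data.Product using (Σ; _×_; _,_; proj₁; proj₂)
open import Relation.Nullary using (¬_; yes; no)
open import Relation.Nullary.Negation using (contradiction)
open import Relation.Unary using (Pred; Decidable)
open import Relation.Unary.Properties using (∁?)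
open import Relation.Binary.PropositionalEquality

module _ {a} {A : Set a} where

  lookup-injective : ∀ {xs : List A} → Unique xs → ∀ {i j} → lookup xs i ≡ lookup xs j → i ≡ j
  lookup-injective (_ ∷ _)   {zero}  {zero}  _  = refl
  lookup-injective (x∉ ∷ _)  {zero}  {suc j} eq = contradiction eq (All.lookup x∉ (∈-lookup j))
  lookup-injective (x∉ ∷ _)  {suc i} {zero}  eq = contradiction (sym eq) (All.lookup x∉ (∈-lookup i))
  lookup-injective (_ ∷ xs!) {suc i} {suc j} eq = cong suc (lookup-injective xs! eq)

  length-filter-∁ : ∀ {p} {P : Pred A p} (P? : Decidable P) (xs : List A) →
    length xs ≡ length (filter P? xs) + length (filter (∁? P?) xs)
  length-filter-∁ P? []       = refl
  length-filter-∁ P? (x ∷ xs) with P? x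
  ... | yes _ = cong suc (length-filter-∁ P? xs)
  ... | no  _ = trans (cong suc (length-filter-∁ P? xs)) (sym (+-suc _ _))

module _ {a b} {A : Set a} {B : Set b} where

  injectiveOn⇒length-≤ : ∀ (f : A → B) {xs : List A} {ys : List B} → Unique xs →
    (∀ {x y} → x ∈ xs → y ∈ xs → f x ≡ f y → x ≡ y) →
    (∀ {x} → x ∈ xs → f x ∈ ys) →
    length xs ≤ length ys
  injectiveOn⇒length-≤ f {xs} xs! f-inj f∈ = injective⇒≤ position-injective
    where
    position = λ i → index (f∈ (∈-lookup {xs = xs} i))
    position-injective : ∀ {i j} → position i ≡ position j → i ≡ j
    position-injective {i} {j} eq = lookup-injective xs!
      (f-inj (∈-lookup i) (∈-lookup j)
        (SetoidMembership.index-injective (setoid B) (f∈ (∈-lookup i)) (f∈ (∈-lookup j)) eq))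

divisors : ℕ → List ℕ
divisors m = filter (_∣? m) (map suc (upTo m))

divisors-unique : ∀ m → Unique (divisors m)
divisors-unique m = Unique.filter⁺ (_∣? m) (Unique.map⁺ suc-injective (Unique.upTo⁺ m))

∈-divisors⁻ : ∀ {m d} → d ∈ divisors m → d ∣ m
∈-divisors⁻ {m} d∈ = proj₂ (∈-filter⁻ (_∣? m) {xs = map suc (upTo m)} d∈)

∣-nonZero : ∀ {m d} .{{_ : NonZero m}} → d ∣ m → NonZero d
∣-nonZero {m} {zero}  d∣m = contradiction (0∣⇒≡0 d∣m) (≢-nonZero⁻¹ m)
∣-nonZero {m} {suc _} d∣m = _

∈-divisors⁺ : ∀ {m d} .{{_ : NonZero m}} → d ∣ m → d ∈ divisors m
∈-divisors⁺ {m} {zero}  d∣m = contradiction (0∣⇒≡0 d∣m) (≢-nonZero⁻¹ m)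
∈-divisors⁺ {m} {suc i} d∣m = ∈-filter⁺ (_∣? m) (∈-map⁺ suc (∈-upTo⁺ (∣⇒≤ d∣m))) d∣m

-- m / d, with the junk value 0 at d = 0 so that no NonZero d instance is needed.
codivisor : ℕ → ℕ → ℕ
codivisor m zero    = 0
codivisor m (suc d) = m / suc d

codivisor-* : ∀ {m d} → d ∣ m → codivisor m d * d ≡ m
codivisor-* {m} {zero}  d∣m = sym (0∣⇒≡0 d∣m)
codivisor-* {m} {suc d} d∣m = m/n*n≡m d∣m

codivisor-∣ : ∀ {m d} → d ∣ m → codivisor m d ∣ m
codivisor-∣ {d = d} d∣m = divides d (trans (sym (codivisor-* d∣m)) (*-comm _ d))

codivisor-injective : ∀ {m x y} .{{_ : NonZero m}} → x ∣ m → y ∣ m →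
  codivisor m x ≡ codivisor m y → x ≡ y
codivisor-injective {m} {x} {y} x∣m y∣m eq = *-cancelˡ-≡ x y q (begin
  q * x               ≡⟨ cong (_* x) eq ⟨
  codivisor m x * x   ≡⟨ codivisor-* x∣m ⟩
  m                   ≡⟨ codivisor-* y∣m ⟨
  q * y               ∎)
  where
  open ≡-Reasoning
  q = codivisor m y
  instance
    q≢0 : NonZero q
    q≢0 = ∣-nonZero (codivisor-∣ y∣m)

smallDivisors largeDivisors : ℕ → List ℕ
smallDivisors m = filter (λ d → d * d ≤? m) (divisors m)
largeDivisors m = filter (∁? (λ d → d * d ≤? m)) (divisors m)

smallDivisors-unique : ∀ m → Unique (smallDivisors m)
smallDivisors-unique m = Unique.filter⁺ (λ d → d * d ≤? m) (divisors-unique m)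

largeDivisors-unique : ∀ m → Unique (largeDivisors m)
largeDivisors-unique m = Unique.filter⁺ (∁? (λ d → d * d ≤? m)) (divisors-unique m)

τ≡small+large : ∀ m → τ m ≡ length (smallDivisors m) + length (largeDivisors m)
τ≡small+large m = length-filter-∁ (λ d → d * d ≤? m) (divisors m)

codivisor∈smallDivisors : ∀ {m d} .{{_ : NonZero m}} → d ∣ m → m ≤ d * d →
  codivisor m d ∈ smallDivisors m
codivisor∈smallDivisors {m} {d} d∣m m≤d² =
  ∈-filter⁺ (λ d → d * d ≤? m) (∈-divisors⁺ (codivisor-∣ d∣m)) (begin
    q * q  ≤⟨ *-monoʳ-≤ q q≤d ⟩
    q * d  ≡⟨ codivisor-* d∣m ⟩
    m      ∎)
  where
  open ≤-Reasoning
  q = codivisor m d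
  instance
    d≢0 : NonZero d
    d≢0 = ∣-nonZero d∣m
  q≤d : q ≤ d
  q≤d = *-cancelʳ-≤ q d d (subst (_≤ d * d) (sym (codivisor-* d∣m)) m≤d²)

module _ {m : ℕ} .{{_ : NonZero m}} where

  UpperDivisor : ℕ → Set
  UpperDivisor d = d ∣ m × m ≤ d * d

  -- d ↦ m / d sends the divisors with d² ≥ m injectively into those with d² ≤ m.
  length-≤-smallDivisors : ∀ {xs} → Unique xs → All UpperDivisor xs →
    length xs ≤ length (smallDivisors m)
  length-≤-smallDivisors xs! upper = injectiveOn⇒length-≤ (codivisor m) xs!
    (λ x∈ y∈ → codivisor-injective (proj₁ (All.lookup upper x∈)) (proj₁ (All.lookup upper y∈)))
    (λ d∈ → codivisor∈smallDivisors (proj₁ (All.lookup upper d∈)) (proj₂ (All.lookup upper d∈)))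

  ∈-largeDivisors⁻ : ∀ {d} → d ∈ largeDivisors m → d ∣ m × m < d * d
  ∈-largeDivisors⁻ d∈
    with d∈D , d²≰m ← ∈-filter⁻ (∁? (λ d → d * d ≤? m)) {xs = divisors m} d∈ =
    ∈-divisors⁻ d∈D , ≰⇒> d²≰m

  largeDivisors-upper : All UpperDivisor (largeDivisors m)
  largeDivisors-upper = All.tabulate λ d∈ →
    let d∣m , m<d² = ∈-largeDivisors⁻ d∈ in d∣m , <⇒≤ m<d²

  large≤small : length (largeDivisors m) ≤ length (smallDivisors m)
  large≤small = length-≤-smallDivisors (largeDivisors-unique m) largeDivisors-upper

  -- k = √m is fixed by d ↦ m / d and is not large, so it extends the injection above.
  square⇒large<small : IsSquare m → length (largeDivisors m) < length (smallDivisors m)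
  square⇒large<small (k , k²≡m) =
    length-≤-smallDivisors (All.tabulate k≢large ∷ largeDivisors-unique m)
      ((divides k (sym k²≡m) , ≤-reflexive (sym k²≡m)) ∷ largeDivisors-upper)
    where
    k≢large : ∀ {d} → d ∈ largeDivisors m → k ≢ d
    k≢large d∈ refl = <-irrefl (sym k²≡m) (proj₂ (∈-largeDivisors⁻ d∈))

  τ≤2*small : τ m ≤ 2 * length (smallDivisors m)
  τ≤2*small = begin
    τ m       ≡⟨ τ≡small+large m ⟩
    s + l     ≤⟨ +-monoʳ-≤ s large≤small ⟩
    s + s     ≡⟨ cong (s +_) (+-identityʳ s) ⟨
    2 * s     ∎
    where
    open ≤-Reasoning
    s = length (smallDivisors m)
    l = length (largeDivisors m)

  τ+1≤2*small : IsSquare m → τ m + 1 ≤ 2 * length (smallDivisors m)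
  τ+1≤2*small m-square = begin
    τ m + 1        ≡⟨ cong (_+ 1) (τ≡small+large m) ⟩
    s + l + 1      ≡⟨ +-assoc s l 1 ⟩
    s + (l + 1)    ≡⟨ cong (s +_) (+-comm l 1) ⟩
    s + suc l      ≤⟨ +-monoʳ-≤ s (square⇒large<small m-square) ⟩
    s + s          ≡⟨ cong (s +_) (+-identityʳ s) ⟨
    2 * s          ∎
    where
    open ≤-Reasoning
    s = length (smallDivisors m)
    l = length (largeDivisors m)

pairProducts-inImage : ∀ {λs} → IsPartition λs → InImagePre2 (pairProducts λs)
pairProducts-inImage {λs} λs-partition = λs , λs-partition , ↭-refl

pairProducts₃-isPartition : ∀ {a b c} → IsPartition (a ∷ b ∷ c ∷ []) →
  IsPartition (pairProducts (a ∷ b ∷ c ∷ []))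
pairProducts₃-isPartition {a} {b} {c} ((b≤a ∷ c≤b ∷ [-]) , (0<a ∷ 0<b ∷ 0<c ∷ [])) =
  (*-monoʳ-≤ a c≤b ∷ *-monoˡ-≤ c b≤a ∷ [-]) ,
  (*-mono-< 0<a 0<b ∷ *-mono-< 0<a 0<c ∷ *-mono-< 0<b 0<c ∷ [])

suc-sum-pairProducts₃ : ∀ a b → suc (sum (pairProducts (a ∷ b ∷ 1 ∷ []))) ≡ suc a * suc b
suc-sum-pairProducts₃ a b = identity a b
  where
  identity : ∀ a b → suc (a * b + (a * 1 + (b * 1 + 0))) ≡ suc a * suc b
  identity = solve-∀

pairProducts₂-isPartitionOf : ∀ {a b} → IsPartition (a ∷ b ∷ []) →
  IsPartitionOf (a * b) (pairProducts (a ∷ b ∷ []))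
pairProducts₂-isPartitionOf {a} {b} (_ , (0<a ∷ 0<b ∷ [])) =
  ([-] , (*-mono-< 0<a 0<b ∷ [])) , +-identityʳ (a * b)

pre₂Preimage : ℕ → ℕ → List ℕ
pre₂Preimage q zero          = []
pre₂Preimage q (suc zero)    = pred q ∷ 1 ∷ []
pre₂Preimage q (suc (suc e)) = pred q ∷ suc e ∷ 1 ∷ []

pairProducts-pre₂Preimage : ∀ {n} q d → 1 ≤ n → q * d ≡ suc n → d * d ≤ suc n →
  let ν = pairProducts (pre₂Preimage q d) in IsPartitionOf n ν × InImagePre2 ν
pairProducts-pre₂Preimage q zero _ qd≡m _ =
  contradiction (trans (sym (*-zeroʳ q)) qd≡m) 0≢1+n
pairProducts-pre₂Preimage zero (suc _) _ () _
pairProducts-pre₂Preimage (suc a) (suc zero) 1≤n a*1≡n _ =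
  subst (λ k → IsPartitionOf k _) (suc-injective a*1≡n) (pairProducts₂-isPartitionOf λs-partition) ,
  pairProducts-inImage λs-partition
  where
  1≤a : 1 ≤ a
  1≤a = subst (1 ≤_) (trans (sym (suc-injective a*1≡n)) (*-identityʳ a)) 1≤n
  λs-partition : IsPartition (a ∷ 1 ∷ [])
  λs-partition = (1≤a ∷ [-]) , (1≤a ∷ s≤s z≤n ∷ [])
pairProducts-pre₂Preimage {n} (suc a) d@(suc (suc e)) _ qd≡m d²≤m =
  (pairProducts₃-isPartition λs-partition , suc-injective (begin
    suc (sum (pairProducts (a ∷ suc e ∷ 1 ∷ [])))  ≡⟨ suc-sum-pairProducts₃ a (suc e) ⟩
    suc a * d                                     ≡⟨ qd≡m ⟩
    suc n                                         ∎)) ,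
  pairProducts-inImage λs-partition
  where
  open ≡-Reasoning
  e<a : suc e ≤ a
  e<a = s≤s⁻¹ (*-cancelʳ-≤ d (suc a) d (subst (d * d ≤_) (sym qd≡m) d²≤m))
  λs-partition : IsPartition (a ∷ suc e ∷ 1 ∷ [])
  λs-partition = (e<a ∷ s≤s z≤n ∷ [-]) , (<-≤-trans (s≤s z≤n) e<a ∷ s≤s z≤n ∷ s≤s z≤n ∷ [])

divisorOf : List ℕ → ℕ
divisorOf (_ ∷ _ ∷ d-1 ∷ _) = suc d-1
divisorOf ν                 = length ν

divisorOf-pre₂Preimage : ∀ q d → divisorOf (pairProducts (pre₂Preimage q d)) ≡ d
divisorOf-pre₂Preimage q zero          = refl
divisorOf-pre₂Preimage q (suc zero)    = refl
divisorOf-pre₂Preimage q (suc (suc e)) = cong suc (*-identityʳ (suc e))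

divisorPartition : ℕ → ℕ → List ℕ
divisorPartition m d = pairProducts (pre₂Preimage (codivisor m d) d)

divisorPartition-injective : ∀ {m d d′} → divisorPartition m d ≡ divisorPartition m d′ → d ≡ d′
divisorPartition-injective {m} {d} {d′} eq = begin
  d                                ≡⟨ divisorOf-pre₂Preimage (codivisor m d) d ⟨
  divisorOf (divisorPartition m d)  ≡⟨ cong divisorOf eq ⟩
  divisorOf (divisorPartition m d′) ≡⟨ divisorOf-pre₂Preimage (codivisor m d′) d′ ⟩
  d′                               ∎
  where open ≡-Reasoning

divisorPartition-valid : ∀ {n d} → 1 ≤ n → d ∈ smallDivisors (suc n) →
  IsPartitionOf n (divisorPartition (suc n) d) × InImagePre2 (divisorPartition (suc n) d)
divisorPartition-valid {n} {d} 1≤n d∈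
  with d∈D , d²≤m ← ∈-filter⁻ (λ d → d * d ≤? suc n) {xs = divisors (suc n)} d∈ =
  pairProducts-pre₂Preimage (codivisor (suc n) d) d 1≤n (codivisor-* (∈-divisors⁻ d∈D)) d²≤m

theorem1p7 : (n : ℕ) → 1 ≤ n →
    Σ (List (List ℕ)) λ L →
      Unique L × All (λ ν → IsPartitionOf n ν × InImagePre2 ν) L ×
      ((¬ IsSquare (n + 1) → τ (n + 1) ≤ 2 * length L) ×
       (IsSquare (n + 1) → τ (n + 1) + 1 ≤ 2 * length L))
theorem1p7 n 1≤n rewrite +-comm n 1 =
  L ,
  Unique.map⁺ divisorPartition-injective (smallDivisors-unique m) ,
  All.map⁺ (All.tabulate (divisorPartition-valid 1≤n)) ,
  (λ _ → subst (λ k → τ m ≤ 2 * k) length-L (τ≤2*small {m})) ,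
  (λ m-square → subst (λ k → τ m + 1 ≤ 2 * k) length-L (τ+1≤2*small {m} m-square))
  where
  m = suc n
  L = map (divisorPartition m) (smallDivisors m)
  length-L : length (smallDivisors m) ≡ length L
  length-L = sym (length-map (divisorPartition m) (smallDivisors m))
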